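{- For every integer $n \ge 1$, let $a(n)$ denote the number of partitions of $n$ in which the smallest part occurs at least twice, and let $p(2n,n)$ denote the number of partitions of $2n$ whose largest part minus smallest part equals $n$. Then $$a(n) = p(2n,n).$$
   Context: A partition of a positive integer $m$ is a non-increasing sequence of positive integers $\lambda_1 \ge \lambda_2 \ge \dots \ge \lambda_r$ with $\sum_{i=1}^r \lambda_i = m$; the $\lambda_i$ are its parts, $\lambda_1$ is its largest part and $\lambda_r$ its smallest part. "The smallest part occurs at least twice" means that $\lambda_r$ appears at least two times among the parts. $p(2n,n)$ counts partitions $\lambda_1\ge\dots\ge\lambda_r$ of $2n$ with $\lambda_1-\lambda_r=n$. -}

module Defs where

open import Data.Nat using (ℕ; zero; suc; _+_; _*_; _∸_; _≥_; _<_)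
open import Data.List using (List; []; _∷_; head; last; length; filter)
open import Data.Nat.ListAction using (sum)
open import Data.List.Relation.Unary.All using (All)
open import Data.List.Relation.Unary.Linked using (Linked)
open import Data.Maybe using (Maybe; just; nothing)
open import Data.Product using (Σ; ∃; _×_; _,_)
open import Relation.Binary.PropositionalEquality using (_≡_)
open import Data.Nat using (_≟_)

record IsPartition (m : ℕ) (λs : List ℕ) : Set where
  field
    nonIncreasing : Linked _≥_ λs
    positive      : All (0 <_) λs
    sumIs         : sum λs ≡ m

Partition : ℕ → Set
Partition m = Σ (List ℕ) (IsPartition m)

count : ℕ → List ℕ → ℕ
count k λs = length (filter (k ≟_) λs)

SmallestAtLeastTwice : List ℕ → Set
SmallestAtLeastTwice λs = ∃ λ s → last λs ≡ just s × count s λs ≥ 2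

LargestMinusSmallest : ℕ → List ℕ → Set
LargestMinusSmallest d λs =
  ∃ λ l → ∃ λ s → head λs ≡ just l × last λs ≡ just s × l ∸ s ≡ d

A : ℕ → Set
A n = Σ (List ℕ) λ λs → IsPartition n λs × SmallestAtLeastTwice λs

P2nn : ℕ → Set
P2nn n = Σ (List ℕ) λ λs → IsPartition (2 * n) λs × LargestMinusSmallest n λs

-- Let s be the smallest part of a partition of n in which s repeats. Removing one copy of s and
-- adding the part s + n gives a partition of 2n: every old part is at most n, so s + n is the
-- new largest part, while s is still present and smallest. Conversely, a partition of 2n with
-- largest part l = s + n yields, by deleting l and repeating s, a partition of n whose smallest
-- part repeats. All side conditions are proof-irrelevant, so the two maps need only be
-- inverse on the underlying lists.
{-# OPTIONS --safe #-}
module Submission where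

open import Defs
open import Data.Nat using (ℕ; _≥_)
open import Function.Bundles using (_⤖_)

open import Data.Nat using (suc; _+_; _*_; _∸_; _≤_; _<_; _≟_; z≤n; s≤s; s≤s⁻¹)
open import Data.Nat.Properties
open import Data.Nat.Tactic.RingSolver using (solve-∀)
open import Data.Nat.ListAction using (sum)
open import Data.List using (List; []; _∷_; last; length)
open import Data.List.Properties using (filter-accept; filter-reject)
open import Data.List.Relation.Unary.All as All using (All; []; _∷_)
open import Data.List.Relation.Unary.Linked as Linked using (Linked; []; [-]; _∷_)
open import Data.Maybe using (Maybe; just)
open import Data.Maybe.Properties using (just-injective)
import Data.Maybe.Properties as Maybe
open import Data.Empty using (⊥-elim)
open import Data.Product using (Σ; _×_; _,_; proj₁; proj₂)
open import Function.Base using (_∘_)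
open import Function.Bundles using (mk↔ₛ′)
open import Function.Properties.Inverse using (↔⇒⤖)
open import Relation.Binary.Core using (Rel)
open import Relation.Binary.Definitions using (Reflexive)
open import Relation.Binary.PropositionalEquality
open import Relation.Nullary using (¬_; yes; no)
open import Relation.Nullary.Irrelevant using (Irrelevant)
import Axiom.UniquenessOfIdentityProofs as UIP

private
  variable
    X : Set
    x s : X
    xs : List X

dropLast : List X → List X
dropLast []           = []
dropLast (x ∷ [])     = []
dropLast (x ∷ y ∷ ys) = x ∷ dropLast (y ∷ ys)

dupLast : List X → List X
dupLast []           = []
dupLast (x ∷ [])     = x ∷ x ∷ []
dupLast (x ∷ y ∷ ys) = x ∷ dupLast (y ∷ ys)

dropLast-dupLast : (xs : List X) → dropLast (dupLast xs) ≡ xs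
dropLast-dupLast []               = refl
dropLast-dupLast (x ∷ [])         = refl
dropLast-dupLast (x ∷ y ∷ [])     = refl
dropLast-dupLast (x ∷ y ∷ z ∷ zs) = cong (x ∷_) (dropLast-dupLast (y ∷ z ∷ zs))

dupLast-dropLast : (xs : List X) → last (dropLast xs) ≡ last xs → dupLast (dropLast xs) ≡ xs
dupLast-dropLast []               _  = refl
dupLast-dropLast (x ∷ y ∷ [])     eq = cong (λ z → x ∷ z ∷ []) (just-injective eq)
dupLast-dropLast (x ∷ y ∷ z ∷ zs) eq = cong (x ∷_) (dupLast-dropLast (y ∷ z ∷ zs) eq)

last-dupLast : (xs : List X) → last (dupLast xs) ≡ last xs
last-dupLast []               = refl
last-dupLast (x ∷ [])         = refl
last-dupLast (x ∷ y ∷ [])     = refl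
last-dupLast (x ∷ y ∷ z ∷ zs) = last-dupLast (y ∷ z ∷ zs)

last-∷⁺ : ∀ x (xs : List X) → last xs ≡ just s → last (x ∷ xs) ≡ just s
last-∷⁺ _ (_ ∷ _) eq = eq

last-∷⁻ : ∀ x (xs : List X) → last (x ∷ xs) ≡ just s → ¬ s ≡ x → last xs ≡ just s
last-∷⁻ _ []      refl s≢x = ⊥-elim (s≢x refl)
last-∷⁻ _ (_ ∷ _) eq   _   = eq

dropLast-All : {P : X → Set} → All P xs → All P (dropLast xs)
dropLast-All []                = []
dropLast-All (px ∷ [])         = []
dropLast-All (px ∷ py ∷ pys)   = px ∷ dropLast-All (py ∷ pys)

dupLast-All : {P : X → Set} → All P xs → All P (dupLast xs)
dupLast-All []              = []
dupLast-All (px ∷ [])       = px ∷ px ∷ []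
dupLast-All (px ∷ py ∷ pys) = px ∷ dupLast-All (py ∷ pys)

module _ {ℓ} {R : Rel X ℓ} where

  Linked-∷ : All (R x) xs → Linked R xs → Linked R (x ∷ xs)
  Linked-∷ []         []  = [-]
  Linked-∷ (Rxy ∷ _)  Rys = Rxy ∷ Rys

  dropLast-Linked : Linked R xs → Linked R (dropLast xs)
  dropLast-Linked []              = []
  dropLast-Linked [-]             = []
  dropLast-Linked (Rxy ∷ [-])     = [-]
  dropLast-Linked (Rxy ∷ Ryz ∷ l) = Rxy ∷ dropLast-Linked (Ryz ∷ l)

  dupLast-Linked : Reflexive R → Linked R xs → Linked R (dupLast xs)
  dupLast-Linked refl-R []              = []
  dupLast-Linked refl-R [-]             = refl-R ∷ [-]
  dupLast-Linked refl-R (Rxy ∷ [-])     = Rxy ∷ refl-R ∷ [-]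
  dupLast-Linked refl-R (Rxy ∷ Ryz ∷ l) = Rxy ∷ dupLast-Linked refl-R (Ryz ∷ l)

count-∷-≡ : ∀ s (xs : List ℕ) → count s (s ∷ xs) ≡ suc (count s xs)
count-∷-≡ s xs = cong length (filter-accept (s ≟_) refl)

count-∷-≢ : ∀ s (xs : List ℕ) → ¬ s ≡ x → count s (x ∷ xs) ≡ count s xs
count-∷-≢ s xs s≢x = cong length (filter-reject (s ≟_) s≢x)

count-∷-suc : ∀ s x {as bs : List ℕ} →
              count s as ≡ suc (count s bs) → count s (x ∷ as) ≡ suc (count s (x ∷ bs))
count-∷-suc s x {as} {bs} eq with s ≟ x
... | yes refl = trans (count-∷-≡ s as) (trans (cong suc eq) (cong suc (sym (count-∷-≡ s bs))))
... | no s≢x   = trans (count-∷-≢ s as s≢x) (trans eq (cong suc (sym (count-∷-≢ s bs s≢x))))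

count-dropLast : (xs : List ℕ) → last xs ≡ just s → count s xs ≡ suc (count s (dropLast xs))
count-dropLast     (x ∷ [])     refl = count-∷-≡ x []
count-dropLast {s} (x ∷ y ∷ ys) eq = count-∷-suc s x (count-dropLast (y ∷ ys) eq)

sum-dropLast : (xs : List ℕ) → last xs ≡ just s → sum (dropLast xs) + s ≡ sum xs
sum-dropLast (x ∷ [])     refl = sym (+-identityʳ x)
sum-dropLast (x ∷ y ∷ ys) eq   = trans (+-assoc x _ _) (cong (x +_) (sum-dropLast (y ∷ ys) eq))

sum-dupLast : (xs : List ℕ) → last xs ≡ just s → sum (dupLast xs) ≡ sum xs + s
sum-dupLast {s} xs eq = begin
  sum (dupLast xs)                   ≡⟨ sum-dropLast (dupLast xs) (trans (last-dupLast xs) eq) ⟨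
  sum (dropLast (dupLast xs)) + s    ≡⟨ cong (λ ys → sum ys + s) (dropLast-dupLast xs) ⟩
  sum xs + s                         ∎
  where open ≡-Reasoning

dupLast-SmallestAtLeastTwice : (xs : List ℕ) → last xs ≡ just s →
                               SmallestAtLeastTwice (dupLast xs)
dupLast-SmallestAtLeastTwice {s} xs eq =
  s , last-dup , subst (2 ≤_) (sym count-dup) (s≤s (s≤s z≤n))
  where
    open ≡-Reasoning
    last-dup : last (dupLast xs) ≡ just s
    last-dup = trans (last-dupLast xs) eq
    count-dup : count s (dupLast xs) ≡ 2 + count s (dropLast xs)
    count-dup = begin
      count s (dupLast xs)                   ≡⟨ count-dropLast (dupLast xs) last-dup ⟩
      suc (count s (dropLast (dupLast xs)))  ≡⟨ cong (suc ∘ count s) (dropLast-dupLast xs) ⟩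
      suc (count s xs)                       ≡⟨ cong suc (count-dropLast xs eq) ⟩
      2 + count s (dropLast xs)              ∎

last-≤-All : Linked _≥_ xs → last xs ≡ just s → All (s ≤_) xs
last-≤-All [-]             refl = ≤-refl ∷ []
last-≤-All (x≥y ∷ ys-desc) eq   = ≤-trans (All.head below) x≥y ∷ below
  where below = last-≤-All ys-desc eq

last≡lowerBound : Linked _≥_ xs → All (s ≤_) xs → count s xs ≥ 1 → last xs ≡ just s
last≡lowerBound {xs = x ∷ []} {s} [-] _ c with s ≟ x
... | yes refl = refl
... | no s≢x   = ⊥-elim (1+n≰n (≤-trans c (≤-reflexive (count-∷-≢ s [] s≢x))))
last≡lowerBound {xs = x ∷ y ∷ ys} {s} (x≥y ∷ desc) (s≤x ∷ s≤ys) c with s ≟ x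
... | no s≢x   = last≡lowerBound desc s≤ys (≤-trans c (≤-reflexive (count-∷-≢ s (y ∷ ys) s≢x)))
... | yes refl with ≤-antisym x≥y (All.head s≤ys)
... | refl     = last≡lowerBound desc s≤ys (subst (1 ≤_) (sym (count-∷-≡ s ys)) (s≤s z≤n))

last-dropLast : (xs : List ℕ) → Linked _≥_ xs → last xs ≡ just s → count s xs ≥ 2 →
                last (dropLast xs) ≡ just s
last-dropLast xs desc eq c =
  last≡lowerBound (dropLast-Linked desc) (dropLast-All (last-≤-All desc eq))
    (s≤s⁻¹ (subst (2 ≤_) (count-dropLast xs eq) c))

All-≤-sum : (xs : List ℕ) → All (_≤ sum xs) xs
All-≤-sum []       = []
All-≤-sum (x ∷ xs) = m≤m+n x (sum xs) ∷ All.map (λ y≤ → ≤-trans y≤ (m≤n+m _ x)) (All-≤-sum xs)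

m∸n≡o⇒n+o≡m : ∀ {m n o} → o ≥ 1 → m ∸ n ≡ o → n + o ≡ m
m∸n≡o⇒n+o≡m {m} {n} o≥1 m∸n≡o =
  trans (cong (n +_) (sym m∸n≡o)) (m+[n∸m]≡n (<⇒≤ (m∸n≢0⇒n<m {m} {n} m∸n≢0)))
  where
    m∸n≢0 : ¬ m ∸ n ≡ 0
    m∸n≢0 eq = <⇒≢ o≥1 (sym (trans (sym m∸n≡o) eq))

[s+n]+d≡[d+s]+n : ∀ s n d → (s + n) + d ≡ (d + s) + n
[s+n]+d≡[d+s]+n = solve-∀

n+n≡2*n : ∀ n → n + n ≡ 2 * n
n+n≡2*n = solve-∀

d+s≡n⇒[s+n]+d≡2*n : ∀ s n d → d + s ≡ n → (s + n) + d ≡ 2 * n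
d+s≡n⇒[s+n]+d≡2*n s n d eq =
  trans ([s+n]+d≡[d+s]+n s n d) (trans (cong (_+ n) eq) (n+n≡2*n n))

[s+n]+d≡2*n⇒d+s≡n : ∀ s n d → (s + n) + d ≡ 2 * n → d + s ≡ n
[s+n]+d≡2*n⇒d+s≡n s n d eq =
  +-cancelʳ-≡ n _ _ (trans (sym ([s+n]+d≡[d+s]+n s n d)) (trans eq (sym (n+n≡2*n n))))

Σ-≡-irrelevant : {P : X → Set} → (∀ x → Irrelevant (P x)) →
                 {u v : Σ X P} → proj₁ u ≡ proj₁ v → u ≡ v
Σ-≡-irrelevant irr {x , p} {_ , q} refl = cong (x ,_) (irr x p q)

×-irrelevant : {P Q : X → Set} → (∀ x → Irrelevant (P x)) → (∀ x → Irrelevant (Q x)) →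
               ∀ x → Irrelevant (P x × Q x)
×-irrelevant P-irr Q-irr x (p , q) (p′ , q′) = cong₂ _,_ (P-irr x p p′) (Q-irr x q q′)

Maybe-≡-irrelevant : {a b : Maybe ℕ} (p q : a ≡ b) → p ≡ q
Maybe-≡-irrelevant = UIP.Decidable⇒UIP.≡-irrelevant (Maybe.≡-dec _≟_)

IsPartition-irrelevant : ∀ {m} xs → Irrelevant (IsPartition m xs)
IsPartition-irrelevant _ record { nonIncreasing = d ; positive = p ; sumIs = e }
                       record { nonIncreasing = d′ ; positive = p′ ; sumIs = e′ }
  rewrite Linked.irrelevant ≤-irrelevant d d′
        | All.irrelevant ≤-irrelevant p p′
        | ≡-irrelevant e e′ = refl

SmallestAtLeastTwice-irrelevant : ∀ xs → Irrelevant (SmallestAtLeastTwice xs)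
SmallestAtLeastTwice-irrelevant _ (s , e , c) (s′ , e′ , c′)
  with just-injective (trans (sym e) e′)
... | refl = cong₂ (λ e c → s , e , c) (Maybe-≡-irrelevant e e′) (≤-irrelevant c c′)

LargestMinusSmallest-irrelevant : ∀ {d} xs → Irrelevant (LargestMinusSmallest d xs)
LargestMinusSmallest-irrelevant _ (l , s , h , e , c) (l′ , s′ , h′ , e′ , c′)
  with just-injective (trans (sym h) h′) | just-injective (trans (sym e) e′)
... | refl | refl
  rewrite Maybe-≡-irrelevant h h′ | Maybe-≡-irrelevant e e′ | ≡-irrelevant c c′ = refl

module _ {n : ℕ} (n≥1 : n ≥ 1) where
  open IsPartition

  -- n ≥ 1 forces s < l, ruling out both the truncation in l ∸ s and the one-part list l = s.
  P2nn-split : ∀ l rest {s} → last (l ∷ rest) ≡ just s → l ∸ s ≡ n →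
               s + n ≡ l × last rest ≡ just s
  P2nn-split l rest {s} last≡s l∸s≡n = s+n≡l , last-∷⁻ l rest last≡s (<⇒≢ s<l)
    where
      s+n≡l = m∸n≡o⇒n+o≡m n≥1 l∸s≡n
      s<l : s < l
      s<l = subst (s <_) s+n≡l (m<m+n s n≥1)

  to : A n → P2nn n
  to (xs , part , s , last≡s , twice) =
    (s + n ∷ dropLast xs) ,
    record
      { nonIncreasing = Linked-∷ (All.map (λ y≤n → ≤-trans y≤n (m≤n+m n s)) bounded)
                                 (dropLast-Linked (nonIncreasing part))
      ; positive      = ≤-trans n≥1 (m≤n+m n s) ∷ dropLast-All (positive part)
      ; sumIs         = d+s≡n⇒[s+n]+d≡2*n s n _ (trans (sum-dropLast xs last≡s) (sumIs part))
      } ,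
    (s + n , s , refl , last-∷⁺ (s + n) (dropLast xs) last-init , m+n∸m≡n s n)
    where
      last-init : last (dropLast xs) ≡ just s
      last-init = last-dropLast xs (nonIncreasing part) last≡s twice
      bounded : All (_≤ n) (dropLast xs)
      bounded = dropLast-All (subst (λ m → All (_≤ m) xs) (sumIs part) (All-≤-sum xs))

  from : P2nn n → A n
  from ([] , _ , _ , _ , () , _)
  from (l ∷ rest , part , _ , s , refl , last≡s , l∸s≡n) =
    dupLast rest ,
    record
      { nonIncreasing = dupLast-Linked ≤-refl (Linked.tail (nonIncreasing part))
      ; positive      = dupLast-All (All.tail (positive part))
      ; sumIs         = trans (sum-dupLast rest last-rest) ([s+n]+d≡2*n⇒d+s≡n s n (sum rest) sum≡2n)
      } ,
    dupLast-SmallestAtLeastTwice rest last-rest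
    where
      s+n≡l = proj₁ (P2nn-split l rest last≡s l∸s≡n)
      last-rest = proj₂ (P2nn-split l rest last≡s l∸s≡n)
      sum≡2n : (s + n) + sum rest ≡ 2 * n
      sum≡2n = subst (λ a → a + sum rest ≡ 2 * n) (sym s+n≡l) (sumIs part)

  to∘from : ∀ b → to (from b) ≡ b
  to∘from ([] , _ , _ , _ , () , _)
  to∘from (l ∷ rest , _ , _ , s , refl , last≡s , l∸s≡n) =
    Σ-≡-irrelevant (×-irrelevant IsPartition-irrelevant LargestMinusSmallest-irrelevant)
      (cong₂ _∷_ (proj₁ (P2nn-split l rest last≡s l∸s≡n)) (dropLast-dupLast rest))

  from∘to : ∀ a → from (to a) ≡ a
  from∘to (xs , part , s , last≡s , twice) =
    Σ-≡-irrelevant (×-irrelevant IsPartition-irrelevant SmallestAtLeastTwice-irrelevant)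
      (dupLast-dropLast xs (trans (last-dropLast xs (nonIncreasing part) last≡s twice) (sym last≡s)))

mainTheorem2 : (n : ℕ) → n ≥ 1 → A n ⤖ P2nn n
mainTheorem2 n n≥1 = ↔⇒⤖ (mk↔ₛ′ (to n≥1) (from n≥1) (to∘from n≥1) (from∘to n≥1))
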